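{- For a temporal flow network $\big(G(L)=(V,E,L),s,t,c\big)$ with unbounded node buffers, the minimum capacity of an $s$-$t$ cut in the static network $\mathrm{TEG}(L)$ equals the minimum capacity of an $s$-$t$ cut in the static network $\mathrm{STEG}(L)$.
   Context: A temporal graph $G(L)=(V,E,L)$: finite digraph $G=(V,E)$, each edge $e$ having a finite set $L_e\subseteq\mathbb{N}$ of positive integer labels; time edges $(u,v,l)$ with $(u,v)\in E$, $l\in L_{(u,v)}$, their set being $E_L$; $l_{max}$ is the maximum label. The network has source $s$, sink $t$, edge capacities $c(e)>0$ and infinite node buffers. The time-extended network $\mathrm{TEG}(L)=(V^*,E^*)$ has vertices: for each $v\in V$ and each $i=0,1,\dots,l_{max}$ a copy $v_i$, and a copy $v_{l+1/2}$ whenever $(x,v,l)\in E_L$ for some $x$. The simplified time-extended network $\mathrm{STEG}(L)=(V',E')$ has vertices: for each $v\in V$ a copy $v_0$, a copy $v_l$ whenever $(v,x,l)\in E_L$ for some $x$, and a copy $v_{l+1/2}$ whenever $(x,v,l)\in E_L$ for some $x$. In both networks the edges are: for each $v$, a vertical edge of infinite capacity from each copy $v_i$ of $v$ to the next copy of $v$ (the copy $v_j$ in the network with smallest index $j>i$); and for each time edge $(u,v,l)$, a crossing edge $(u_l,v_{l+1/2})$ of capacity $c(u,v)$. In both networks the source is the first copy of $s$ and the sink the last copy of $t$.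
   Formalization: The edge capacities c(e) take values in the positive rationals. -}

module Defs where

open import Data.Nat as ℕ using (ℕ; zero; suc)
open import Data.Fin using (Fin)
open import Data.Bool using (Bool; true; false; _∧_; not; if_then_else_)
open import Data.List using (List; map; foldr; upTo; allFin)
open import Data.Rational as ℚ using (ℚ; 0ℚ)
open import Data.Product using (Σ; ∃; ∃₂; _×_; _,_)
open import Data.Sum using (_⊎_)
open import Relation.Binary.PropositionalEquality using (_≡_; _≢_)
open import Relation.Nullary using (¬_)

-- Vertices V = Fin n.  lab u v l ≡ true  means  l ∈ L_(u,v), i.e.
-- (u,v,l) is a time edge (pairs with no labels play no role).
-- Capacities are positive rationals (closest available to reals).

record TemporalNetwork : Set where
  field
    n       : ℕ
    lmax    : ℕ
    lab     : Fin n → Fin n → ℕ → Bool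
    lab-pos : ∀ u v l → lab u v l ≡ true → 1 ℕ.≤ l
    lab-le  : ∀ u v l → lab u v l ≡ true → l ℕ.≤ lmax
    lmax-is-max : lmax ≡ 0 ⊎ ∃₂ λ u v → lab u v lmax ≡ true
    cap     : Fin n → Fin n → ℚ
    cap-pos : ∀ u v → 0ℚ ℚ.< cap u v
    s t     : Fin n
    s≢t     : s ≢ t

-- Indices of copies: ⌊ i ⌋ is v_i, l +½ is v_{l+1/2}.

data Idx : Set where
  ⌊_⌋ : ℕ → Idx
  _+½ : ℕ → Idx

-- position on the time axis (doubled)
key : Idx → ℕ
key ⌊ i ⌋  = 2 ℕ.* i
key (l +½) = suc (2 ℕ.* l)

sumℚ : List ℚ → ℚ
sumℚ = foldr ℚ._+_ 0ℚ

data ℚ∞ : Set where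
  fin : ℚ → ℚ∞
  ∞   : ℚ∞

data _≤∞_ : ℚ∞ → ℚ∞ → Set where
  fin≤fin : ∀ {a b} → a ℚ.≤ b → fin a ≤∞ fin b
  _≤∞∞    : ∀ a → a ≤∞ ∞

module _ (N : TemporalNetwork) where
  open TemporalNetwork N

  TEGCopy : Fin n → Idx → Set
  TEGCopy v ⌊ i ⌋  = i ℕ.≤ lmax
  TEGCopy v (l +½) = ∃ λ x → lab x v l ≡ true

  STEGCopy : Fin n → Idx → Set
  STEGCopy v ⌊ i ⌋  = i ≡ 0 ⊎ ∃ λ x → lab v x i ≡ true
  STEGCopy v (l +½) = ∃ λ x → lab x v l ≡ true

  -- A cut is given by the indicator S of its source side.
  Side : Set
  Side = Fin n → Idx → Bool

  module Network (Copy : Fin n → Idx → Set) where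

    IsFirst : Fin n → Idx → Set
    IsFirst v i = Copy v i × (∀ k → Copy v k → key i ℕ.≤ key k)

    IsLast : Fin n → Idx → Set
    IsLast v j = Copy v j × (∀ k → Copy v k → key k ℕ.≤ key j)

    -- vertical edge v_i → v_j (j the next copy of v after i), infinite capacity
    Vertical : Fin n → Idx → Idx → Set
    Vertical v i j = Copy v i × Copy v j × key i ℕ.< key j
                   × (∀ k → Copy v k → key i ℕ.< key k → key j ℕ.≤ key k)

    IsCut : Side → Set
    IsCut S = (∀ i → IsFirst s i → S s i ≡ true)
            × (∀ j → IsLast t j → S t j ≡ false)

    VerticalCrossing : Side → Set
    VerticalCrossing S = Σ (Fin n) λ v → Σ Idx λ i → Σ Idx λ j →
      Vertical v i j × S v i ≡ true × S v j ≡ false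

    crossingSum : Side → ℚ
    crossingSum S =
      sumℚ (map (λ u → sumℚ (map (λ v → sumℚ (map (λ l →
        if lab u v l ∧ S u ⌊ l ⌋ ∧ not (S v (l +½)) then cap u v else 0ℚ)
        (upTo (suc lmax)))) (allFin n))) (allFin n))

  module Network′ (Copy : Fin n → Idx → Set) where
    open Network Copy public

    data CapIs (S : Side) : ℚ∞ → Set where
      infinite : VerticalCrossing S → CapIs S ∞
      finite   : ¬ VerticalCrossing S → CapIs S (fin (crossingSum S))

    IsMinCut : ℚ∞ → Set
    IsMinCut m = (∃ λ S → IsCut S × CapIs S m)
               × (∀ S m′ → IsCut S → CapIs S m′ → m ≤∞ m′)

  IsMinCutTEG : ℚ∞ → Set
  IsMinCutTEG = Network′.IsMinCut TEGCopy

  IsMinCutSTEG : ℚ∞ → Set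
  IsMinCutSTEG = Network′.IsMinCut STEGCopy

module Submission where

-- Both networks consist, for every vertex v, of a chain of copies of v
-- joined by infinite vertical edges, plus the same crossing edges
-- (u_l, v_{l+1/2}).  A cut of finite capacity cannot cut a vertical edge,
-- so along each chain its source side is upward closed: it is described by
-- a threshold time τ_v (copies at time ≥ τ_v lie on the source side), with
-- τ_s = 0 and τ_t beyond the last copy.  The capacity of a cut only depends
-- on the endpoints of crossing edges, which exist in both networks, so
-- every finite cut has the capacity of the "threshold cut" of its
-- threshold vector τ, and every threshold cut is a finite cut in either
-- network.  Hence both minimum cuts equal the least capacity of a
-- threshold cut, which exists because thresholds range over a finite set.

open import Defs
open import Data.Bool as Bool using (Bool; true; false; if_then_else_; not; _∧_)
open import Data.Empty using (⊥-elim)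
open import Data.Fin using (Fin) renaming (_≟_ to _≟ᶠ_)
open import Data.Fin.Properties using (any?)
open import Data.List using (List; [_]; map; upTo; allFin; cartesianProductWith)
open import Data.List.Properties using (map-cong)
open import Data.List.Membership.Propositional using (_∈_; lose)
open import Data.List.Membership.Propositional.Properties
  using (∈-cartesianProductWith⁺; ∈-upTo⁺)
open import Data.List.Relation.Unary.Any using (here)
import Data.List.Extrema
open import Data.Nat using (ℕ; zero; suc; _+_; _≤_; _<_; _∸_; z≤n; s≤s; _≟_; _≤?_; _<?_)
open import Data.Nat.Properties
open import Data.Product using (Σ; _×_; _,_; proj₁; proj₂)
open import Data.Rational as ℚ using (ℚ)
import Data.Rational.Properties as ℚ
open import Data.Sum using (_⊎_; inj₁; inj₂)
open import Data.Vec using (Vec; []; _∷_; lookup; tabulate; replicate)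
open import Data.Vec.Properties using (lookup∘tabulate)
open import Data.Vec.Relation.Unary.All using (All; []; _∷_)
open import Data.Vec.Relation.Unary.All.Properties using (tabulate⁺)
open import Relation.Nullary using (Dec; yes; no; ¬_; does)
open import Relation.Nullary.Decidable using (dec-true; _×-dec_; _⊎-dec_)
open import Relation.Unary using (Decidable)
open import Relation.Binary.Bundles using (DecTotalOrder)
open import Relation.Binary.PropositionalEquality using (_≡_; _≢_; refl; sym; trans; cong; subst)

does-unique : ∀ {P : Set} {b : Bool} (P? : Dec P) →
              (b ≡ true → P) → (P → b ≡ true) → b ≡ does P?
does-unique {b = true}  (yes _)  _   _   = refl
does-unique {b = true}  (no ¬p)  b⇒P _   = ⊥-elim (¬p (b⇒P refl))
does-unique {b = false} (yes p)  _   P⇒b = P⇒b p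
does-unique {b = false} (no _)   _   _   = refl

true≢false : true ≢ false
true≢false ()

from-does : ∀ {P : Set} (P? : Dec P) → does P? ≡ true → P
from-does (yes p) _ = p

module Search {P : ℕ → Set} (P? : Decidable P) where

  below : ∀ {m k} → ¬ P m → k < suc m → P k → k < m
  below {m} ¬pm k<1+m pk with m<1+n⇒m<n∨m≡n k<1+m
  ... | inj₁ k<m = k<m
  ... | inj₂ refl = ⊥-elim (¬pm pk)

  leastBelow : ∀ m → (Σ ℕ λ c → P c × (∀ k → P k → c ≤ k)) ⊎ (∀ k → k < m → ¬ P k)
  leastBelow zero = inj₂ λ _ ()
  leastBelow (suc m) with leastBelow m
  ... | inj₁ found = inj₁ found
  ... | inj₂ none with P? m
  ...   | yes pm = inj₁ (m , pm , λ k pk → ≮⇒≥ λ k<m → none k k<m pk)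
  ...   | no ¬pm = inj₂ λ k k<1+m pk → none k (below ¬pm k<1+m pk) pk

  greatestBelow : ∀ m → (Σ ℕ λ c → P c × (∀ k → P k → k < m → k ≤ c))
                      ⊎ (∀ k → k < m → ¬ P k)
  greatestBelow zero = inj₂ λ _ ()
  greatestBelow (suc m) with P? m
  ... | yes pm = inj₁ (m , pm , λ _ _ k<1+m → ≤-pred k<1+m)
  ... | no ¬pm with greatestBelow m
  ...   | inj₁ (c , pc , max) = inj₁ (c , pc , λ k pk k<1+m → max k pk (below ¬pm k<1+m pk))
  ...   | inj₂ none = inj₂ λ k k<1+m pk → none k (below ¬pm k<1+m pk) pk

  least : ∀ {b} → P b → Σ ℕ λ c → P c × (∀ k → P k → c ≤ k)
  least {b} pb with leastBelow (suc b)
  ... | inj₁ found = found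
  ... | inj₂ none  = ⊥-elim (none b ≤-refl pb)

  greatest : ∀ {B b} → (∀ k → P k → k ≤ B) → P b →
             Σ ℕ λ c → P c × (∀ k → P k → k ≤ c)
  greatest {B} {b} bounded pb with greatestBelow (suc B)
  ... | inj₁ (c , pc , max) = c , pc , λ k pk → max k pk (s≤s (bounded k pk))
  ... | inj₂ none = ⊥-elim (none b (s≤s (bounded b pb)) pb)

Consecutive : (ℕ → Set) → ℕ → ℕ → Set
Consecutive C a b = C a × C b × a < b × (∀ k → C k → a < k → b ≤ k)

module Chain {C : ℕ → Set} (C? : Decidable C) {B : ℕ}
             (bounded : ∀ k → C k → k ≤ B) (f : ℕ → Bool)
             (step : ∀ {a b} → Consecutive C a b → f a ≡ true → f b ≡ true) where

  successor : ∀ {a b} → C a → C b → a < b → Σ ℕ λ c → Consecutive C a c × c ≤ b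
  successor {a} {b} ca cb a<b with Search.least (λ k → C? k ×-dec (a <? k)) (cb , a<b)
  ... | c , (cc , a<c) , min = c , (ca , cc , a<c , λ k ck a<k → min k (ck , a<k)) , min b (cb , a<b)

  -- induction on an upper bound d of the distance b ∸ a
  upward-within : ∀ d {a b} → b ∸ a ≤ d → C a → C b → a ≤ b → f a ≡ true → f b ≡ true
  upward-within zero dist _ _ a≤b fa =
    subst (λ x → f x ≡ true) (≤-antisym a≤b (m∸n≡0⇒m≤n (n≤0⇒n≡0 dist))) fa
  upward-within (suc d) {a} {b} dist ca cb a≤b fa with m≤n⇒m<n∨m≡n a≤b
  ... | inj₂ refl = fa
  ... | inj₁ a<b with successor ca cb a<b
  ...   | c , next@(_ , cc , a<c , _) , c≤b =
    upward-within d (≤-pred (≤-trans (∸-monoʳ-< a<c c≤b) dist)) cc cb c≤b (step next fa)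

  upward : ∀ {a b} → C a → C b → a ≤ b → f a ≡ true → f b ≡ true
  upward {a} {b} = upward-within (b ∸ a) ≤-refl

  -- the threshold τ: the least element of C labelled true, or B+1 if none is
  threshold : Σ ℕ λ τ → τ ≤ suc B × (∀ q → C q → f q ≡ does (τ ≤? q))
  threshold with Search.leastBelow (λ k → C? k ×-dec (f k Bool.≟ true)) (suc B)
  ... | inj₁ (τ , (cτ , fτ) , min) = τ , m≤n⇒m≤1+n (bounded τ cτ) , λ q cq →
    does-unique (τ ≤? q) (λ fq → min q (cq , fq)) (λ τ≤q → upward cτ cq τ≤q fτ)
  ... | inj₂ none = suc B , ≤-refl , λ q cq →
    does-unique (suc B ≤? q) (λ fq → ⊥-elim (none q (s≤s (bounded q cq)) (cq , fq)))
                             (λ B<q → ⊥-elim (<⇒≱ B<q (bounded q cq)))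

vectorsOver : {A : Set} → List A → ∀ k → List (Vec A k)
vectorsOver R zero    = [ [] ]
vectorsOver R (suc k) = cartesianProductWith _∷_ R (vectorsOver R k)

∈-vectorsOver : ∀ {A : Set} {R : List A} {k} {w : Vec A k} →
                All (_∈ R) w → w ∈ vectorsOver R k
∈-vectorsOver []            = here refl
∈-vectorsOver (x∈R ∷ w∈R) = ∈-cartesianProductWith⁺ _∷_ x∈R (∈-vectorsOver w∈R)

-- Copy indices are coded by their doubled time `key`, a bijection onto ℕ;
-- this lets chains of copies be searched as subsets of ℕ.
shift : Idx → Idx
shift ⌊ i ⌋  = ⌊ suc i ⌋
shift (l +½) = suc l +½

fromKey : ℕ → Idx
fromKey zero          = ⌊ 0 ⌋
fromKey (suc zero)    = 0 +½
fromKey (suc (suc k)) = shift (fromKey k)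

key-shift : ∀ x → key (shift x) ≡ suc (suc (key x))
key-shift ⌊ i ⌋  = cong suc (+-suc i (i + 0))
key-shift (l +½) = cong (λ k → suc (suc k)) (+-suc l (l + 0))

key-fromKey : ∀ k → key (fromKey k) ≡ k
key-fromKey zero          = refl
key-fromKey (suc zero)    = refl
key-fromKey (suc (suc k)) = trans (key-shift (fromKey k)) (cong (λ j → suc (suc j)) (key-fromKey k))

fromKey-key : ∀ x → fromKey (key x) ≡ x
fromKey-key ⌊ zero ⌋    = refl
fromKey-key ⌊ suc i ⌋   = trans (cong fromKey (key-shift ⌊ i ⌋)) (cong shift (fromKey-key ⌊ i ⌋))
fromKey-key (zero +½)   = refl
fromKey-key (suc l +½)  = trans (cong fromKey (key-shift (l +½))) (cong shift (fromKey-key (l +½)))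

key-⌊⌋≤+½ : ∀ {i l} → i ≤ l → key ⌊ i ⌋ ≤ key (l +½)
key-⌊⌋≤+½ i≤l = m≤n⇒m≤1+n (*-monoʳ-≤ 2 i≤l)

key-+½-mono : ∀ {l l′} → l ≤ l′ → key (l +½) ≤ key (l′ +½)
key-+½-mono l≤l′ = s≤s (*-monoʳ-≤ 2 l≤l′)

module _ (N : TemporalNetwork) where
  open TemporalNetwork N

  -- every copy in either network lies at or before v_{lmax+1/2}
  horizon : ℕ
  horizon = key (lmax +½)

  record Admissible (Copy : Fin n → Idx → Set) : Set where
    field
      copy?     : ∀ v i → Dec (Copy v i)
      bounded   : ∀ v i → Copy v i → key i ≤ horizon
      initial   : ∀ v → Copy v ⌊ 0 ⌋
      tail-copy : ∀ {u v l} → lab u v l ≡ true → Copy u ⌊ l ⌋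
      head-copy : ∀ {u v l} → lab u v l ≡ true → Copy v (l +½)

  -- The capacity of the crossing edges cut by S; its definition does not
  -- depend on which copies exist, so it is the same for both networks.
  crossingCapacity : Side N → ℚ
  crossingCapacity = Network.crossingSum N (TEGCopy N)

  crossingCapacity-cong : ∀ (S S′ : Side N) →
    (∀ {u v l} → lab u v l ≡ true → S u ⌊ l ⌋ ≡ S′ u ⌊ l ⌋ × S v (l +½) ≡ S′ v (l +½)) →
    crossingCapacity S ≡ crossingCapacity S′
  crossingCapacity-cong S S′ agree =
    cong sumℚ (map-cong (λ u → cong sumℚ (map-cong (λ v →
      cong sumℚ (map-cong (term u v) (upTo (suc lmax)))) (allFin n))) (allFin n))
    where
    term : ∀ u v l →
      (if lab u v l ∧ S u ⌊ l ⌋ ∧ not (S v (l +½)) then cap u v else ℚ.0ℚ) ≡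
      (if lab u v l ∧ S′ u ⌊ l ⌋ ∧ not (S′ v (l +½)) then cap u v else ℚ.0ℚ)
    term u v l with lab u v l in e
    ... | false = refl
    ... | true with agree e
    ...   | tail≡ , head≡ rewrite tail≡ | head≡ = refl

  thresholdCut : Vec ℕ n → Side N
  thresholdCut τ v i =
    if does (v ≟ᶠ s) then true
    else if does (v ≟ᶠ t) then false
    else does (lookup τ v ≤? key i)

  thresholdCut-upward : ∀ τ v {i j} → key i ≤ key j →
                        thresholdCut τ v i ≡ true → thresholdCut τ v j ≡ true
  thresholdCut-upward τ v {i} {j} i≤j vᵢ with does (v ≟ᶠ s) | does (v ≟ᶠ t)
  ... | true  | _     = refl
  ... | false | true  = vᵢ
  ... | false | false = dec-true (lookup τ v ≤? key j) (≤-trans (from-does (lookup τ v ≤? key i) vᵢ) i≤j)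

  module _ (Copy : Fin n → Idx → Set) where
    open Network N Copy

    thresholdCut-isCut : ∀ τ → IsCut (thresholdCut τ)
    thresholdCut-isCut τ = (λ i _ → source i) , (λ j _ → sink j)
      where
      source : ∀ i → thresholdCut τ s i ≡ true
      source i with s ≟ᶠ s
      ... | yes _  = refl
      ... | no s≢s = ⊥-elim (s≢s refl)
      sink : ∀ j → thresholdCut τ t j ≡ false
      sink j with t ≟ᶠ s | t ≟ᶠ t
      ... | yes t≡s | _      = ⊥-elim (s≢t (sym t≡s))
      ... | no _    | yes _  = refl
      ... | no _    | no t≢t = ⊥-elim (t≢t refl)

    thresholdCut-finite : ∀ τ → ¬ VerticalCrossing (thresholdCut τ)
    thresholdCut-finite τ (v , i , j , (_ , _ , i<j , _) , vᵢ , vⱼ) =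
      true≢false (trans (sym (thresholdCut-upward τ v {i} {j} (<⇒≤ i<j) vᵢ)) vⱼ)

  -- Threshold vectors with entries in {0, …, horizon+1}: this finite set
  -- contains the threshold vector of every finite cut.
  thresholds : List (Vec ℕ n)
  thresholds = vectorsOver (upTo (suc (suc horizon))) n

  value : Vec ℕ n → ℚ
  value τ = crossingCapacity (thresholdCut τ)

  open Data.List.Extrema (DecTotalOrder.totalOrder ℚ.≤-decTotalOrder) using (argmin; f[argmin]≤v⁺)

  optimal : Vec ℕ n
  optimal = argmin value (replicate n 0) thresholds

  optimal-≤ : ∀ {τ} → τ ∈ thresholds → value optimal ℚ.≤ value τ
  optimal-≤ τ∈ = f[argmin]≤v⁺ (replicate n 0) thresholds (inj₂ (lose τ∈ ℚ.≤-refl))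

  module MinCut {Copy : Fin n → Idx → Set} (admissible : Admissible Copy) where
    open Admissible admissible
    open Network′ N Copy

    module FiniteCut (S : Side N) (cut : IsCut S) (finite-S : ¬ VerticalCrossing S) where

      module AtVertex (v : Fin n) where
        C : ℕ → Set
        C k = Copy v (fromKey k)

        f : ℕ → Bool
        f k = S v (fromKey k)

        toC : ∀ {x} → Copy v x → C (key x)
        toC {x} = subst (Copy v) (sym (fromKey-key x))

        f-key : ∀ x → f (key x) ≡ S v x
        f-key x = cong (S v) (fromKey-key x)

        C-bounded : ∀ k → C k → k ≤ horizon
        C-bounded k ck = subst (_≤ horizon) (key-fromKey k) (bounded v (fromKey k) ck)

        vertical : ∀ {a b} → Consecutive C a b → Vertical v (fromKey a) (fromKey b)
        vertical {a} {b} (ca , cb , a<b , next) rewrite key-fromKey a | key-fromKey b =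
          ca , cb , a<b , λ k ck a<k → next (key k) (toC ck) a<k

        -- a finite cut never leaves a vertical edge
        no-descent : ∀ {a b} → Consecutive C a b → f a ≡ true → f b ≡ true
        no-descent {a} {b} next fa with f b in fb
        ... | true  = refl
        ... | false = ⊥-elim (finite-S (v , fromKey a , fromKey b , vertical next , fa , fb))

        open Chain (λ k → copy? v (fromKey k)) C-bounded f no-descent
          using () renaming (upward to upwardᴺ; threshold to thresholdᴺ)

        upward : ∀ {x y} → Copy v x → Copy v y → key x ≤ key y → S v x ≡ true → S v y ≡ true
        upward {x} {y} cx cy x≤y Sx =
          trans (sym (f-key y)) (upwardᴺ {key x} {key y} (toC cx) (toC cy) x≤y (trans (f-key x) Sx))

        threshold : ℕ
        threshold = proj₁ thresholdᴺ

        threshold-bound : threshold ≤ suc horizon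
        threshold-bound = proj₁ (proj₂ thresholdᴺ)

        threshold-spec : ∀ {x} → Copy v x → S v x ≡ does (threshold ≤? key x)
        threshold-spec {x} cx = trans (sym (f-key x)) (proj₂ (proj₂ thresholdᴺ) (key x) (toC cx))

        lastCopy : ∀ {x} → Copy v x → Σ Idx λ j → IsLast v j × key x ≤ key j
        lastCopy {x} cx with Search.greatest (λ k → copy? v (fromKey k)) {b = key x} C-bounded (toC cx)
        ... | c , cc , max = fromKey c , (cc , λ k ck → ≤-key (max (key k) (toC ck))) , ≤-key (max (key x) (toC cx))
          where
          ≤-key : ∀ {m} → m ≤ c → m ≤ key (fromKey c)
          ≤-key = subst (_ ≤_) (sym (key-fromKey c))

      -- all copies of s lie on the source side, as the first copy s₀ does
      source-side : ∀ {x} → Copy s x → S s x ≡ true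
      source-side cx = upward (initial s) cx z≤n (proj₁ cut ⌊ 0 ⌋ (initial s , λ _ _ → z≤n))
        where open AtVertex s

      -- all copies of t lie on the sink side, as the last copy does
      sink-side : ∀ {x} → Copy t x → S t x ≡ false
      sink-side {x} cx with S t x in Sx | AtVertex.lastCopy t cx
      ... | false | _ = refl
      ... | true  | j , last , x≤j =
        ⊥-elim (true≢false (trans (sym (AtVertex.upward t cx (proj₁ last) x≤j Sx)) (proj₂ cut j last)))

      τ : Vec ℕ n
      τ = tabulate AtVertex.threshold

      agrees : ∀ v {x} → Copy v x → S v x ≡ thresholdCut τ v x
      agrees v {x} cx with v ≟ᶠ s | v ≟ᶠ t
      ... | yes refl | _        = source-side cx
      ... | no _     | yes refl = sink-side cx
      ... | no _     | no _ rewrite lookup∘tabulate AtVertex.threshold v = AtVertex.threshold-spec v cx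

      capacity-agrees : crossingCapacity S ≡ value τ
      capacity-agrees = crossingCapacity-cong S (thresholdCut τ) λ {u} {v} e →
        agrees u (tail-copy e) , agrees v (head-copy e)

      τ-candidate : τ ∈ thresholds
      τ-candidate = ∈-vectorsOver (tabulate⁺ λ v → ∈-upTo⁺ (s≤s (AtVertex.threshold-bound v)))

    minCut : IsMinCut (fin (value optimal))
    minCut = (thresholdCut optimal , thresholdCut-isCut Copy optimal , finite (thresholdCut-finite Copy optimal))
           , below-every-cut
      where
      below-every-cut : ∀ S m → IsCut S → CapIs S m → fin (value optimal) ≤∞ m
      below-every-cut S _ cut (infinite _)   = _ ≤∞∞
      below-every-cut S _ cut (finite finite-S) =
        fin≤fin (subst (value optimal ℚ.≤_) (sym capacity-agrees) (optimal-≤ τ-candidate))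
        where open FiniteCut S cut finite-S

module _ (N : TemporalNetwork) where
  open TemporalNetwork N

  lab? : ∀ u v l → Dec (lab u v l ≡ true)
  lab? u v l = lab u v l Bool.≟ true

  teg-admissible : Admissible N (TEGCopy N)
  teg-admissible = record
    { copy?     = λ { v ⌊ i ⌋ → i ≤? lmax ; v (l +½) → any? λ x → lab? x v l }
    ; bounded   = λ { v ⌊ i ⌋ i≤lmax → key-⌊⌋≤+½ i≤lmax
                    ; v (l +½) (x , e) → key-+½-mono (lab-le x v l e) }
    ; initial   = λ _ → z≤n
    ; tail-copy = λ {u} {v} {l} → lab-le u v l
    ; head-copy = λ {u} e → u , e
    }

  steg-admissible : Admissible N (STEGCopy N)
  steg-admissible = record
    { copy?     = λ { v ⌊ i ⌋ → (i ≟ 0) ⊎-dec any? (λ x → lab? v x i)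
                    ; v (l +½) → any? λ x → lab? x v l }
    ; bounded   = λ { v ⌊ i ⌋ (inj₁ refl) → z≤n
                    ; v ⌊ i ⌋ (inj₂ (x , e)) → key-⌊⌋≤+½ (lab-le v x i e)
                    ; v (l +½) (x , e) → key-+½-mono (lab-le x v l e) }
    ; initial   = λ _ → inj₁ refl
    ; tail-copy = λ {u} {v} e → inj₂ (v , e)
    ; head-copy = λ {u} e → u , e
    }

lemma4 : (N : TemporalNetwork) →
    Σ ℚ∞ λ m → IsMinCutTEG N m × IsMinCutSTEG N m
lemma4 N = fin (value N (optimal N))
         , MinCut.minCut N (teg-admissible N)
         , MinCut.minCut N (steg-admissible N)
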